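{- Let $G=(V,E)$ be a $k$-edge-connected graph and $\eta=1/40$. Let $\mathcal{R}$ be the family obtained by adding one side of each $\eta$-near minimum cut that crosses no other $\eta$-near minimum cut, and, for each connected component $\mathcal{C}$ (under crossing) of $\eta$-near minimum cuts with $|\mathcal{C}|>1$, a laminar family $\mathcal{L}_P$ of cuts each of which is a union of atoms of $\mathcal{A}(\mathcal{C})$. Then $\mathcal{R}$ is a cross-free family.
   Context: An $\eta$-near minimum cut is a cut $S$ with $|\delta(S)|<(1+\eta)k$. Two cuts $S,T$ cross if $S\cap T$, $S\setminus T$, $T\setminus S$, $V\setminus(S\cup T)$ are all nonempty; a family is cross-free if no two members cross. The atoms $\mathcal{A}(\mathcal{C})$ of a component $\mathcal{C}$ are the coarsest partition of $V$ such that each part is contained in or disjoint from every cut of $\mathcal{C}$ (for $|\mathcal{C}|=1$ the atoms are the two sides of the single cut). The laminar families $\mathcal{L}_P$ are those produced by the paper's construction on the polygon representation $P$ of $\mathcal{C}$; the proof uses only that each is laminar (hence cross-free) and consists of unions of atoms of $\mathcal{A}(\mathcal{C})$, together with Benczúr's lemma that for two distinct components $\mathcal{C},\mathcal{C}'$ there exist atoms $a\in\mathcal{A}(\mathcal{C})$, $a'\in\mathcal{A}(\mathcal{C}')$ with $a\cup a'=V$. -}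

module Defs where

open import Data.Nat using (ℕ; zero; suc; _≤_; _<_; _*_)
open import Data.Bool using (Bool; true; false; _xor_)
open import Data.Fin using (Fin)
open import Data.Fin.Subset using (Subset; _∈_; _∉_; ∁; _∩_; _⊆_; Nonempty)
open import Data.List using (List; []; _∷_)
open import Data.Vec using (lookup)
open import Data.Product using (_×_; _,_; ∃; Σ)
open import Data.Sum using (_⊎_)
open import Relation.Nullary using (¬_)
open import Relation.Binary.PropositionalEquality using (_≡_)

-- A (multi)graph on vertex set V = Fin n, given by its list of edges.
-- Loops contribute to no cut.
Graph : ℕ → Set
Graph n = List (Fin n × Fin n)

δ : ∀ {n} → Graph n → Subset n → ℕ
δ []             S = 0
δ ((u , v) ∷ es) S with lookup S u xor lookup S v
... | true  = suc (δ es S)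
... | false = δ es S

IsCut : ∀ {n} → Subset n → Set
IsCut S = Nonempty S × Nonempty (∁ S)

EdgeConnectivity : ∀ {n} → Graph n → ℕ → Set
EdgeConnectivity G k =
  (∀ S → IsCut S → k ≤ δ G S) × ∃ λ S → IsCut S × δ G S ≡ k

-- η-near minimum cut with η = 1/40 :  |δ(S)| < (1 + 1/40) k  ⇔  40 |δ(S)| < 41 k.
NearMin : ∀ {n} → Graph n → ℕ → Subset n → Set
NearMin G k S = IsCut S × 40 * δ G S < 41 * k

Cross : ∀ {n} → Subset n → Subset n → Set
Cross S T = Nonempty (S ∩ T) × Nonempty (S ∩ ∁ T) × Nonempty (∁ S ∩ T)
          × Nonempty (∁ S ∩ ∁ T)

CrossFree : ∀ {n} → (Subset n → Set) → Set
CrossFree F = ∀ X Y → F X → F Y → ¬ Cross X Y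

Laminar : ∀ {n} → (Subset n → Set) → Set
Laminar F = ∀ X Y → F X → F Y → X ⊆ Y ⊎ Y ⊆ X ⊎ (∀ v → v ∈ X → v ∉ Y)

data Linked {n} (G : Graph n) (k : ℕ) : Subset n → Subset n → Set where
  here : ∀ {S} → Linked G k S S
  step : ∀ {S T U} → NearMin G k T → Cross S T → Linked G k T U → Linked G k S U

-- The component (of near-min cuts under crossing) containing the cut S.
-- A cut is identified with its complement, so T belongs to the component
-- of S if T or its complement is linked to S.
InComp : ∀ {n} → Graph n → ℕ → Subset n → Subset n → Set
InComp G k S T = NearMin G k T × (Linked G k S T ⊎ Linked G k S (∁ T))

-- Near-min cuts crossing no other near-min cut (components with |C| = 1).
Isolated : ∀ {n} → Graph n → ℕ → Subset n → Set
Isolated G k S = NearMin G k S × (∀ T → NearMin G k T → ¬ Cross S T)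

-- Near-min cuts lying in a component with more than one cut.
NonIsolated : ∀ {n} → Graph n → ℕ → Subset n → Set
NonIsolated G k S = NearMin G k S × ∃ λ T → NearMin G k T × Cross S T

-- u and v lie in the same atom of A(C(S)): no cut of the component separates them.
SameAtom : ∀ {n} → Graph n → ℕ → Subset n → Fin n → Fin n → Set
SameAtom G k S u v = ∀ T → InComp G k S T → (u ∈ T → v ∈ T) × (v ∈ T → u ∈ T)

UnionOfAtoms : ∀ {n} → Graph n → ℕ → Subset n → Subset n → Set
UnionOfAtoms G k S X = ∀ u v → SameAtom G k S u v → u ∈ X → v ∈ X

R : ∀ {n} → Graph n → ℕ → (Subset n → Set) → (Subset n → Subset n → Set)
  → Subset n → Set
R G k Pick L X = Pick X ⊎ ∃ λ S → NonIsolated G k S × L S X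

{-# OPTIONS --safe #-}
-- If a set Z crosses no cut of a crossing component C, then one side of Z lies
-- inside a single atom of C. Indeed Z does not cross some cut S of C, so one
-- side of Z lies within a side of S; and this persists along crossings: were
-- the other side of Z within a side of T, with S crossing T, the quadrant of S
-- and T avoiding both of these sides would be nonempty, yet it misses all of V.
-- Hence no union of atoms of C crosses Z. This applies when Z is an isolated
-- cut, and when Z is a union of atoms of another component C′: a cut of C′
-- crossing a cut of C would merge the two components. Within one component the
-- family is laminar. This argument replaces Benczúr's lemma.
module Submission where

open import Defs
open import Data.Nat using (ℕ)
open import Data.Bool using (Bool; true; false; not) renaming (_≟_ to _≟ᵇ_)
open import Data.Bool.Properties using (¬-not)
open import Data.Fin.Subset using (Subset; ∁; _∈_; _∉_; _∩_; _⊆_; Nonempty; Empty)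
open import Data.Fin.Subset.Properties
  using (_∈?_; nonempty?; x∈p∩q⁺; x∈p∩q⁻; x∈∁p⇒x∉p; x∉p⇒x∈∁p; x∉∁p⇒x∈p)
open import Data.Product using (_×_; _,_; proj₁; proj₂; ∃; ∃₂; swap)
open import Data.Sum using (_⊎_; inj₁; inj₂)
open import Data.Empty using (⊥-elim)
open import Function using (id; _∘_)
open import Relation.Nullary using (¬_; yes; no)
open import Relation.Nullary.Decidable using (¬¬-excluded-middle)
open import Relation.Binary.PropositionalEquality using (refl; subst)

module _ {n : ℕ} where

  side : Subset n → Bool → Subset n
  side S true  = S
  side S false = ∁ S

  ∈side-not⇒∉side : ∀ {x S} b → x ∈ side S (not b) → x ∉ side S b
  ∈side-not⇒∉side true  x∈∁S     = x∈∁p⇒x∉p x∈∁S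
  ∈side-not⇒∉side false x∈S x∈∁S = x∈∁p⇒x∉p x∈∁S x∈S

  ∉side⇒∈side-not : ∀ {x S} b → x ∉ side S b → x ∈ side S (not b)
  ∉side⇒∈side-not true  = x∉p⇒x∈∁p
  ∉side⇒∈side-not false = x∉∁p⇒x∈p

  ∈side-dichotomy : ∀ x S b → x ∈ side S b ⊎ x ∈ side S (not b)
  ∈side-dichotomy x S b with x ∈? side S b
  ... | yes x∈ = inj₁ x∈
  ... | no  x∉ = inj₂ (∉side⇒∈side-not b x∉)

  ∈side-∁ : ∀ {x T} b → x ∈ side (∁ T) b → x ∈ side T (not b)
  ∈side-∁ true  = id
  ∈side-∁ false = x∉∁p⇒x∈p ∘ x∈∁p⇒x∉p

  ∈sameSide : ∀ {u v T} t → u ∈ side T t → v ∈ side T t → u ∈ T → v ∈ T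
  ∈sameSide true  _    v∈T _   = v∈T
  ∈sameSide false u∈∁T _   u∈T = ⊥-elim (x∈∁p⇒x∉p u∈∁T u∈T)

  cross⇒quadrant : ∀ {S T} → Cross S T → ∀ a b → Nonempty (side S a ∩ side T b)
  cross⇒quadrant (q , _ , _ , _) true  true  = q
  cross⇒quadrant (_ , q , _ , _) true  false = q
  cross⇒quadrant (_ , _ , q , _) false true  = q
  cross⇒quadrant (_ , _ , _ , q) false false = q

  ¬cross⇒emptyQuadrant : ∀ {Z T} → ¬ Cross Z T → ∃₂ λ a b → Empty (side Z a ∩ side T b)
  ¬cross⇒emptyQuadrant {Z} {T} Z∤T
    with nonempty? (Z ∩ T) | nonempty? (Z ∩ ∁ T) | nonempty? (∁ Z ∩ T) | nonempty? (∁ Z ∩ ∁ T)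
  ... | no e  | _     | _     | _     = true  , true  , e
  ... | yes _ | no e  | _     | _     = true  , false , e
  ... | yes _ | yes _ | no e  | _     = false , true  , e
  ... | yes _ | yes _ | yes _ | no e  = false , false , e
  ... | yes p | yes q | yes r | yes s = ⊥-elim (Z∤T (p , q , r , s))

  cross-sym : ∀ {S T} → Cross S T → Cross T S
  cross-sym {S} {T} (p , q , r , s) = flip S T p , flip (∁ S) T r , flip S (∁ T) q , flip (∁ S) (∁ T) s
    where
    flip : ∀ (P Q : Subset n) → Nonempty (P ∩ Q) → Nonempty (Q ∩ P)
    flip P Q (x , x∈) = x , x∈p∩q⁺ (swap (x∈p∩q⁻ P Q x∈))

  laminar⇒crossFree : ∀ {F : Subset n → Set} → Laminar F → CrossFree F
  laminar⇒crossFree lam X Y FX FY (X∩Y , X∖Y , Y∖X , _) with lam X Y FX FY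
  ... | inj₁ X⊆Y =
    let (x , x∈) = X∖Y ; (x∈X , x∈∁Y) = x∈p∩q⁻ X (∁ Y) x∈ in x∈∁p⇒x∉p x∈∁Y (X⊆Y x∈X)
  ... | inj₂ (inj₁ Y⊆X) =
    let (x , x∈) = Y∖X ; (x∈∁X , x∈Y) = x∈p∩q⁻ (∁ X) Y x∈ in x∈∁p⇒x∉p x∈∁X (Y⊆X x∈Y)
  ... | inj₂ (inj₂ X∩Y≡∅) =
    let (x , x∈) = X∩Y ; (x∈X , x∈Y) = x∈p∩q⁻ X Y x∈ in X∩Y≡∅ x x∈X x∈Y

  record SideWithin (Z : Subset n) (z : Bool) (T : Subset n) : Set where
    constructor _,_
    field
      sideOfT  : Bool
      ⊆sideOfT : side Z z ⊆ side T sideOfT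

  emptyQuadrant⇒sideWithin : ∀ {Z T} a b → Empty (side Z a ∩ side T b) → SideWithin Z a T
  emptyQuadrant⇒sideWithin a b e =
    not b , λ x∈Za → ∉side⇒∈side-not b (λ x∈Tb → e (_ , x∈p∩q⁺ (x∈Za , x∈Tb)))

  ¬cross⇒sideWithin : ∀ {Z T} → ¬ Cross Z T → ∃ λ z → SideWithin Z z T
  ¬cross⇒sideWithin Z∤T =
    let (a , b , e) = ¬cross⇒emptyQuadrant Z∤T in a , emptyQuadrant⇒sideWithin a b e

  sideWithin-∁ : ∀ {Z z T} → SideWithin Z z (∁ T) → SideWithin Z z T
  sideWithin-∁ (t , Zz⊆∁Tt) = not t , λ x∈Zz → ∈side-∁ t (Zz⊆∁Tt x∈Zz)

  sidesWithin⇒¬cross : ∀ {Z S T} z → SideWithin Z z S → SideWithin Z (not z) T → ¬ Cross S T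
  sidesWithin⇒¬cross {Z} {S} {T} z (s , Zz⊆Ss) (t , Zz̄⊆Tt) S×T
    with cross⇒quadrant S×T (not s) (not t)
  ... | x , x∈ with x∈p∩q⁻ (side S (not s)) (side T (not t)) x∈ | ∈side-dichotomy x Z z
  ...   | x∈S̄ , _   | inj₁ x∈Zz = ∈side-not⇒∉side s x∈S̄ (Zz⊆Ss x∈Zz)
  ...   | _   , x∈T̄ | inj₂ x∈Zz̄ = ∈side-not⇒∉side t x∈T̄ (Zz̄⊆Tt x∈Zz̄)

  sideWithin-cross : ∀ {Z z S T} → SideWithin Z z S → Cross S T → ¬ Cross Z T → SideWithin Z z T
  sideWithin-cross {Z} {z} {T = T} w S×T Z∤T with ¬cross⇒sideWithin Z∤T
  ... | z′ , w′ with z′ ≟ᵇ z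
  ...   | yes refl = w′
  ...   | no  z′≢z =
    ⊥-elim (sidesWithin⇒¬cross z w (subst (λ b → SideWithin Z b T) (¬-not z′≢z) w′) S×T)

module _ {n : ℕ} (G : Graph n) (k : ℕ) where

  linked-snoc : ∀ {A B C} → Linked G k A B → NearMin G k C → Cross B C → Linked G k A C
  linked-snoc here             nmC B×C = step nmC B×C here
  linked-snoc (step nmT A×T l) nmC B×C = step nmT A×T (linked-snoc l nmC B×C)

  linked-trans : ∀ {A B C} → Linked G k A B → Linked G k B C → Linked G k A C
  linked-trans here             l′ = l′
  linked-trans (step nmT A×T l) l′ = step nmT A×T (linked-trans l l′)

  linked-sym : ∀ {A B} → NearMin G k A → Linked G k A B → Linked G k B A
  linked-sym _   here             = here
  linked-sym nmA (step nmT A×T l) = linked-snoc (linked-sym nmT l) nmA (cross-sym A×T)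

  CrossesNoLinked : Subset n → Subset n → Set
  CrossesNoLinked S Z = ∀ T → NearMin G k T → Linked G k S T → ¬ Cross Z T

  isolated⇒crossesNoLinked : ∀ {S Z} → Isolated G k Z → CrossesNoLinked S Z
  isolated⇒crossesNoLinked (_ , Z∤) T nmT _ = Z∤ T nmT

  sideWithin-linked : ∀ {Z z S U} → CrossesNoLinked S Z → Linked G k S U
                    → SideWithin Z z S → SideWithin Z z U
  sideWithin-linked _  here             w = w
  sideWithin-linked Z∤ (step nmT S×T l) w =
    sideWithin-linked (λ T′ nmT′ → Z∤ T′ nmT′ ∘ step nmT S×T) l
      (sideWithin-cross w S×T (Z∤ _ nmT (step nmT S×T here)))

  sideWithin-component : ∀ {S Z} → NearMin G k S → CrossesNoLinked S Z
                       → ∃ λ z → ∀ T → InComp G k S T → SideWithin Z z T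
  sideWithin-component nmS Z∤ with ¬cross⇒sideWithin (Z∤ _ nmS here)
  ... | z , w = z , λ where
    T (_ , inj₁ S↝T)  → sideWithin-linked Z∤ S↝T w
    T (_ , inj₂ S↝∁T) → sideWithin-∁ (sideWithin-linked Z∤ S↝∁T w)

  sideWithinComponent⇒sameAtom : ∀ {S Z z u v} → (∀ T → InComp G k S T → SideWithin Z z T)
                               → u ∈ side Z z → v ∈ side Z z → SameAtom G k S u v
  sideWithinComponent⇒sameAtom w u∈Zz v∈Zz T T∈C =
    let (t , Zz⊆Tt) = w T T∈C
    in ∈sameSide t (Zz⊆Tt u∈Zz) (Zz⊆Tt v∈Zz) , ∈sameSide t (Zz⊆Tt v∈Zz) (Zz⊆Tt u∈Zz)

  crossesNoLinked⇒¬cross-unionOfAtoms : ∀ {S Z W} → NearMin G k S → CrossesNoLinked S Z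
                                       → UnionOfAtoms G k S W → ¬ Cross Z W
  crossesNoLinked⇒¬cross-unionOfAtoms {Z = Z} {W} nmS Z∤ W-atoms Z×W
    with sideWithin-component nmS Z∤
  ... | z , w with cross⇒quadrant Z×W z true | cross⇒quadrant Z×W z false
  ...   | u , u∈ | v , v∈ =
    let (u∈Zz , u∈W)  = x∈p∩q⁻ (side Z z) W u∈
        (v∈Zz , v∈∁W) = x∈p∩q⁻ (side Z z) (∁ W) v∈
    in x∈∁p⇒x∉p v∈∁W (W-atoms u v (sideWithinComponent⇒sameAtom w u∈Zz v∈Zz) u∈W)

  unionOfAtoms⇒crossesNoLinked : ∀ {S S′ X} → NearMin G k S → ¬ InComp G k S′ S
                               → UnionOfAtoms G k S X → CrossesNoLinked S′ X
  unionOfAtoms⇒crossesNoLinked nmS S′∉C X-atoms T nmT S′↝T X×T =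
    crossesNoLinked⇒¬cross-unionOfAtoms nmS T∤ X-atoms (cross-sym X×T)
    where
    T∤ : CrossesNoLinked _ T
    T∤ T′ nmT′ S↝T′ T×T′ =
      S′∉C (nmS , inj₁ (linked-trans (linked-snoc S′↝T nmT′ T×T′) (linked-sym nmS S↝T′)))

lemma3p14 : ∀ {n} (G : Graph n) (k : ℕ) → EdgeConnectivity G k
    → (Pick : Subset n → Set)
    → (∀ S → Pick S → Isolated G k S)
    → (∀ S → Isolated G k S → (Pick S ⊎ Pick (∁ S)) × ¬ (Pick S × Pick (∁ S)))
    → (L : Subset n → Subset n → Set)
    → (∀ S S′ X → NonIsolated G k S → InComp G k S S′ → L S X → L S′ X)
    → (∀ S → NonIsolated G k S → Laminar (L S))
    → (∀ S X → NonIsolated G k S → L S X → IsCut X × UnionOfAtoms G k S X)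
    → CrossFree (R G k Pick L)
lemma3p14 G k _ Pick isolated _ L L-component L-laminar L-atoms = crossFree
  where
  atoms : ∀ {S X} → NonIsolated G k S → L S X → UnionOfAtoms G k S X
  atoms niS lX = proj₂ (L-atoms _ _ niS lX)

  picked-¬cross : ∀ {S Z W} → Pick Z → NonIsolated G k S → L S W → ¬ Cross Z W
  picked-¬cross pZ niS lW = crossesNoLinked⇒¬cross-unionOfAtoms G k (proj₁ niS)
    (isolated⇒crossesNoLinked G k (isolated _ pZ)) (atoms niS lW)

  crossFree : CrossFree (R G k Pick L)
  crossFree X Y (inj₁ pX) (inj₁ pY) = proj₂ (isolated X pX) Y (proj₁ (isolated Y pY))
  crossFree X Y (inj₁ pX) (inj₂ (S , niS , lY)) = picked-¬cross pX niS lY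
  crossFree X Y (inj₂ (S , niS , lX)) (inj₁ pY) = picked-¬cross pY niS lX ∘ cross-sym
  crossFree X Y (inj₂ (S , niS , lX)) (inj₂ (S′ , niS′ , lY)) X×Y = ¬¬-excluded-middle λ where
    (yes S′∈C) → laminar⇒crossFree (L-laminar S niS) X Y lX (L-component S′ S Y niS′ S′∈C lY) X×Y
    (no  S′∉C) → crossesNoLinked⇒¬cross-unionOfAtoms G k (proj₁ niS′)
                   (unionOfAtoms⇒crossesNoLinked G k (proj₁ niS) S′∉C (atoms niS lX))
                   (atoms niS′ lY) X×Y
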